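{- The classes $\mathcal{K}_1$ and $\mathcal{K}_2$ are downward-closed subsets of $\mathcal{K}$.
   Context: All graphs are finite and simple. The double subdivision of an edge $uv$ of a graph $G$ is the graph obtained from $G-uv$ by adding two new vertices and joining each of them to both $u$ and $v$. $\mathcal{K}$ is the class of generalised triangles: $K_3$ together with all graphs obtained from $K_3$ by a finite sequence of double subdivisions. For $G,H\in\mathcal{K}$, $H\leq G$ means $G$ can be obtained from $H$ by a (possibly empty) sequence of double subdivisions; $\mathcal{A}\subseteq\mathcal{K}$ is downward-closed if $G\in\mathcal{A}$, $H\in\mathcal{K}$, $H\leq G$ imply $H\in\mathcal{A}$. A $2$-cut of a graph is a set of two vertices whose removal increases the number of components. For a $2$-connected graph $G$ with $2$-cut $\{x,y\}$ and a component $C$ of $G-\{x,y\}$, the induced subgraph $G[V(C)\cup\{x,y\}]$ is an $\{x,y\}$-bridge; it is trivial if it has exactly $3$ vertices. A $2$-cut $\{x,y\}$ has property $P_1$ if for every $\{x,y\}$-bridge $B$, at least one of $x,y$ has degree $1$ in $B$; it has property $P_2$ if at least one $\{x,y\}$-bridge is trivial. For $i\in\{1,2\}$, $\mathcal{K}_i$ is the set of generalised triangles in which every $2$-cut has property $P_i$. -}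

module Defs where

open import Data.Nat using (ℕ; suc; _<_)
open import Data.Fin using (Fin; zero; suc)
open import Data.Empty using (⊥)
open import Data.Unit using (⊤)
open import Data.Product using (Σ; ∃; _×_; _,_; proj₁; proj₂)
open import Data.Sum using (_⊎_; inj₁; inj₂)
open import Relation.Nullary using (¬_)
open import Relation.Binary.PropositionalEquality using (_≡_; _≢_)
open import Function.Bundles using (_↔_; _⇔_; Inverse)

record Graph : Set₁ where
  field
    n      : ℕ
    Adj    : Fin n → Fin n → Set
    sym    : ∀ {u v} → Adj u v → Adj v u
    irrefl : ∀ {u} → ¬ Adj u u

open Graph public

V : Graph → Set
V G = Fin (n G)

record _≅_ (G H : Graph) : Set where
  field
    bij  : V G ↔ V H
    pres : ∀ u v → Adj G u v ⇔ Adj H (Inverse.to bij u) (Inverse.to bij v)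

K3 : Graph
K3 = record
  { n = 3
  ; Adj = λ u v → u ≢ v
  ; sym = λ p q → p (Relation.Binary.PropositionalEquality.sym q)
  ; irrefl = λ p → p Relation.Binary.PropositionalEquality.refl
  }

-- Double subdivision of the edge uv of G.
-- Vertex set Fin (2 + n): zero and suc zero are the two new vertices,
-- suc (suc w) is the old vertex w.

private
  SameEdge : ∀ {m} → Fin m → Fin m → Fin m → Fin m → Set
  SameEdge u v a b = (a ≡ u × b ≡ v) ⊎ (a ≡ v × b ≡ u)

  swapSE : ∀ {m} {u v a b : Fin m} → SameEdge u v a b → SameEdge u v b a
  swapSE (inj₁ (p , q)) = inj₂ (q , p)
  swapSE (inj₂ (p , q)) = inj₁ (q , p)

  IsEnd : ∀ {m} → Fin m → Fin m → Fin m → Set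
  IsEnd u v w = w ≡ u ⊎ w ≡ v

  dAdj : (G : Graph) → V G → V G → Fin (suc (suc (n G))) → Fin (suc (suc (n G))) → Set
  dAdj G u v zero          zero          = ⊥
  dAdj G u v zero          (suc zero)    = ⊥
  dAdj G u v (suc zero)    zero          = ⊥
  dAdj G u v (suc zero)    (suc zero)    = ⊥
  dAdj G u v zero          (suc (suc b)) = IsEnd u v b
  dAdj G u v (suc zero)    (suc (suc b)) = IsEnd u v b
  dAdj G u v (suc (suc a)) zero          = IsEnd u v a
  dAdj G u v (suc (suc a)) (suc zero)    = IsEnd u v a
  dAdj G u v (suc (suc a)) (suc (suc b)) = Adj G a b × ¬ SameEdge u v a b

  dSym : (G : Graph) (u v : V G) → ∀ {a b} → dAdj G u v a b → dAdj G u v b a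
  dSym G u v {zero}          {suc (suc b)} p = p
  dSym G u v {suc zero}      {suc (suc b)} p = p
  dSym G u v {suc (suc a)}   {zero}        p = p
  dSym G u v {suc (suc a)}   {suc zero}    p = p
  dSym G u v {suc (suc a)}   {suc (suc b)} (e , ne) = sym G e , λ s → ne (swapSE s)

  dIrr : (G : Graph) (u v : V G) → ∀ {a} → ¬ dAdj G u v a a
  dIrr G u v {zero}        ()
  dIrr G u v {suc zero}    ()
  dIrr G u v {suc (suc a)} (e , _) = irrefl G e

dsub : (G : Graph) → V G → V G → Graph
dsub G u v = record
  { n = suc (suc (n G))
  ; Adj = dAdj G u v
  ; sym = dSym G u v
  ; irrefl = dIrr G u v
  }

data _≤ᴷ_ : Graph → Graph → Set₁ where
  none : ∀ {H G} → H ≅ G → H ≤ᴷ G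
  step : ∀ {H G G'} → H ≤ᴷ G → (u v : V G) → Adj G u v → dsub G u v ≅ G' → H ≤ᴷ G'

GenTriangle : Graph → Set₁
GenTriangle G = K3 ≤ᴷ G

DownwardClosed : (Graph → Set₁) → Set₁
DownwardClosed A = ∀ G H → A G → GenTriangle H → H ≤ᴷ G → A H

-- Connectivity avoiding a vertex set S (walk from u to w whose vertices
-- after u all lie outside S).

data Reach (G : Graph) (S : V G → Set) : V G → V G → Set where
  here  : ∀ {u} → Reach G S u u
  there : ∀ {u v w} → Adj G u v → ¬ S v → Reach G S v w → Reach G S u w

Outside : (G : Graph) → (V G → Set) → Set
Outside G S = Σ (V G) (λ v → ¬ S v)

NumComponents : (G : Graph) → (V G → Set) → ℕ → Set
NumComponents G S k =
  Σ (Outside G S → Fin k) λ f →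
    (∀ (i : Fin k) → ∃ λ a → f a ≡ i) ×
    (∀ a b → (f a ≡ f b) ⇔ Reach G S (proj₁ a) (proj₁ b))

NoVertex : (G : Graph) → V G → Set
NoVertex G _ = ⊥

Pair : (G : Graph) → V G → V G → V G → Set
Pair G x y w = w ≡ x ⊎ w ≡ y

TwoCut : (G : Graph) → V G → V G → Set
TwoCut G x y = x ≢ y × Σ ℕ λ k → Σ ℕ λ k' →
  NumComponents G (NoVertex G) k × NumComponents G (Pair G x y) k' × k < k'

InComp : (G : Graph) (x y c w : V G) → Set
InComp G x y c w = ¬ Pair G x y w × Reach G (Pair G x y) c w

InBridge : (G : Graph) (x y c w : V G) → Set
InBridge G x y c w = Pair G x y w ⊎ InComp G x y c w

DegOneInBridge : (G : Graph) (x y c z : V G) → Set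
DegOneInBridge G x y c z =
  Σ (V G) λ w → InBridge G x y c w × Adj G z w ×
    (∀ w' → InBridge G x y c w' → Adj G z w' → w' ≡ w)

-- the bridge is trivial: exactly 3 vertices, i.e. the component is {c}
TrivialBridge : (G : Graph) (x y c : V G) → Set
TrivialBridge G x y c = ∀ w → InComp G x y c w → w ≡ c

P1 : (G : Graph) → V G → V G → Set
P1 G x y = ∀ c → ¬ Pair G x y c → DegOneInBridge G x y c x ⊎ DegOneInBridge G x y c y

P2 : (G : Graph) → V G → V G → Set
P2 G x y = Σ (V G) λ c → ¬ Pair G x y c × TrivialBridge G x y c

K₁ : Graph → Set₁
K₁ G = GenTriangle G × (∀ x y → TwoCut G x y → P1 G x y)

K₂ : Graph → Set₁
K₂ G = GenTriangle G × (∀ x y → TwoCut G x y → P2 G x y)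

-- Generalised triangles are connected, stay connected after deleting one vertex or
-- both ends of an edge, and these properties survive double subdivision.  So if G′
-- doubly subdivides the edge uv of G, a 2-cut {x,y} of G is not {u,v}, and contracting
-- the two new vertices onto an end of uv identifies the components (and bridges) of
-- G′ - {x,y} with those of G - {x,y}; thus {x,y} is a 2-cut of G′.  A new vertex is never
-- the unique bridge-neighbour of x or y in G′, since an end of uv sees both new
-- vertices, so P₁ and P₂ pass from G′ back to G, and along isomorphisms trivially.
module Submission where

open import Defs
open import Data.Nat using (zero; suc; _≤_; z≤n; s≤s)
open import Data.Nat.Properties using (≤-trans; <⇒≱)
open import Data.Fin using (Fin; zero; suc; _≟_)
open import Data.Fin.Properties using (suc-injective)
open import Data.Empty using (⊥; ⊥-elim)
open import Data.Product using (Σ; ∃; _×_; _,_; proj₁; proj₂)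
open import Data.Sum using (_⊎_; inj₁; inj₂)
import Data.Sum as Sum
open import Function using (_∘_; id)
open import Function.Bundles using (_⇔_; Inverse; Equivalence; mk⇔)
open import Relation.Nullary using (¬_; Dec; yes; no)
open import Relation.Nullary.Decidable using (_×-dec_; _⊎-dec_)
open import Relation.Binary.PropositionalEquality as ≡ using (_≡_; _≢_; refl; trans; cong; subst; subst₂)

Reach-++ : ∀ {G S p q r} → Reach G S p q → Reach G S q r → Reach G S p r
Reach-++ here           qr = qr
Reach-++ (there e s pq) qr = there e s (Reach-++ pq qr)

Reach-snoc : ∀ {G S p q r} → Reach G S p q → Adj G q r → ¬ S r → Reach G S p r
Reach-snoc pq e r∉ = Reach-++ pq (there e r∉ here)

Reach-sym : ∀ {G S p q} → ¬ S p → Reach G S p q → Reach G S q p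
Reach-sym     p∉ here            = here
Reach-sym {G} p∉ (there e w∉ wq) = Reach-snoc (Reach-sym w∉ wq) (Graph.sym G e) p∉

Reach-map : ∀ {G H S T p q} (f : V G → V H) → (∀ {a b} → Adj G a b → Adj H (f a) (f b)) →
            (∀ w → ¬ S w → ¬ T (f w)) → Reach G S p q → Reach H T (f p) (f q)
Reach-map f f-adj f-out here           = here
Reach-map f f-adj f-out (there e w∉ r) = there (f-adj e) (f-out _ w∉) (Reach-map f f-adj f-out r)

Pair-map : ∀ {G H x y w} (f : V G → V H) → Pair G x y w → Pair H (f x) (f y) (f w)
Pair-map f = Sum.map (cong f) (cong f)

Pair-cong : ∀ {G x x′ y y′ w} → x ≡ x′ → y ≡ y′ → Pair G x y w → Pair G x′ y′ w
Pair-cong refl refl p = p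

Pair? : ∀ {G} x y w → Dec (Pair G x y w)
Pair? x y w = w ≟ x ⊎-dec w ≟ y

Connected : (G : Graph) → (V G → Set) → Set
Connected G S = ∀ p q → ¬ S p → ¬ S q → Reach G S p q

Connected-swap : ∀ {G x y} → Connected G (Pair G x y) → Connected G (Pair G y x)
Connected-swap conn p q p∉ q∉ =
  Reach-map id id (λ _ w∉ → w∉ ∘ Sum.swap) (conn p q (p∉ ∘ Sum.swap) (q∉ ∘ Sum.swap))

connected⇒components≤1 : ∀ {G S k} → Connected G S → NumComponents G S k → k ≤ 1
connected⇒components≤1 {k = zero}        _    _ = z≤n
connected⇒components≤1 {k = suc zero}    _    _ = s≤s z≤n
connected⇒components≤1 {k = suc (suc k)} conn (F , surj , iff)
  with surj zero | surj (suc zero)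
... | (a , a∉) , Fa≡0 | (b , b∉) , Fb≡1
  with trans (≡.sym Fa≡0) (trans (Equivalence.from (iff _ _) (conn a b a∉ b∉)) Fb≡1)
... | ()

vertex⇒components≥1 : ∀ {G k} → V G → NumComponents G (NoVertex G) k → 1 ≤ k
vertex⇒components≥1 {k = zero}  w (F , _) with F (w , λ ())
... | ()
vertex⇒components≥1 {k = suc k} w _ = s≤s z≤n

connected⇒¬TwoCut : ∀ {G x y} → Connected G (Pair G x y) → ¬ TwoCut G x y
connected⇒¬TwoCut {x = x} conn (_ , _ , _ , comps , comps-xy , more) =
  <⇒≱ more (≤-trans (connected⇒components≤1 conn comps-xy) (vertex⇒components≥1 x comps))

record Robust (G : Graph) : Set where
  field
    connected              : Connected G (NoVertex G)
    connected-minus-vertex : ∀ w → Connected G (Pair G w w)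
    connected-minus-edge   : ∀ {x y} → Adj G x y → Connected G (Pair G x y)

edge⇒¬TwoCut : ∀ {G x y} → Robust G → Adj G x y → ¬ TwoCut G x y
edge⇒¬TwoCut R e = connected⇒¬TwoCut (Robust.connected-minus-edge R e)

K3-reach : ∀ {S} p q → ¬ S q → Reach K3 S p q
K3-reach p q q∉ with p ≟ q
... | yes refl = here
... | no p≢q   = there p≢q q∉ here

K3-robust : Robust K3
K3-robust = record
  { connected              = λ p q _ → K3-reach p q
  ; connected-minus-vertex = λ _ p q _ → K3-reach p q
  ; connected-minus-edge   = λ _ p q _ → K3-reach p q
  }

-- Such a pair of maps identifies the components of G - S with those of H - T.
record ReachEquiv (G : Graph) (S : V G → Set) (H : Graph) (T : V H → Set) : Set where
  field
    to           : V G → V H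
    from         : V H → V G
    from-to      : ∀ w → from (to w) ≡ w
    to-from      : ∀ q → ¬ T q → Reach H T (to (from q)) q
    to-outside   : ∀ w → ¬ S w → ¬ T (to w)
    from-outside : ∀ q → ¬ T q → ¬ S (from q)
    to-reach     : ∀ {p q} → Reach G S p q → Reach H T (to p) (to q)
    from-reach   : ∀ {p q} → Reach H T p q → Reach G S (from p) (from q)

  to-injective : ∀ {x y} → to x ≡ to y → x ≡ y
  to-injective {x} {y} eq = trans (≡.sym (from-to x)) (trans (cong from eq) (from-to y))

  reach-via-from : ∀ {p q} → ¬ T p → ¬ T q → Reach G S (from p) (from q) → Reach H T p q
  reach-via-from p∉ q∉ r =
    Reach-++ (Reach-sym (to-outside _ (from-outside _ p∉)) (to-from _ p∉))
             (Reach-++ (to-reach r) (to-from _ q∉))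

  connected : Connected G S → Connected H T
  connected conn p q p∉ q∉ = reach-via-from p∉ q∉ (conn _ _ (from-outside p p∉) (from-outside q q∉))

  numComponents : ∀ {k} → NumComponents G S k → NumComponents H T k
  numComponents {k} (F , surj , iff) = F′ , surj′ , iff′
    where
    F′ : Outside H T → Fin k
    F′ (q , q∉) = F (from q , from-outside q q∉)
    surj′ : ∀ i → ∃ λ a → F′ a ≡ i
    surj′ i with surj i
    ... | (w , w∉) , Fw≡i =
      (to w , to-outside w w∉) ,
      trans (Equivalence.from (iff _ _) (subst (Reach G S (from (to w))) (from-to w) here)) Fw≡i
    iff′ : ∀ a b → (F′ a ≡ F′ b) ⇔ Reach H T (proj₁ a) (proj₁ b)
    iff′ (p , p∉) (q , q∉) = mk⇔
      (reach-via-from p∉ q∉ ∘ Equivalence.to (iff _ _))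
      (Equivalence.from (iff _ _) ∘ from-reach)

twoCut-transfer : ∀ {G H x y x′ y′} → (x′ ≡ y′ → x ≡ y) →
                  ReachEquiv G (NoVertex G) H (NoVertex H) →
                  ReachEquiv G (Pair G x y) H (Pair H x′ y′) →
                  TwoCut G x y → TwoCut H x′ y′
twoCut-transfer inj E₀ E (x≢y , k , k′ , comps , comps-xy , more) =
  x≢y ∘ inj , k , k′ , ReachEquiv.numComponents E₀ comps , ReachEquiv.numComponents E comps-xy , more

module Bridges {G H x y x′ y′} (E : ReachEquiv G (Pair G x y) H (Pair H x′ y′)) where
  open ReachEquiv E

  inComp-to : ∀ {c w} → InComp G x y c w → InComp H x′ y′ (to c) (to w)
  inComp-to (w∉ , r) = to-outside _ w∉ , to-reach r

  inComp-from : ∀ {c w} → InComp H x′ y′ (to c) w → InComp G x y c (from w)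
  inComp-from {c} (w∉ , r) = from-outside _ w∉ , subst (λ z → Reach G (Pair G x y) z _) (from-to c) (from-reach r)

  P2-reflect : P2 H x′ y′ → P2 G x y
  P2-reflect (c , c∉ , trivial) = from c , from-outside c c∉ , λ w w∈ →
    trans (≡.sym (from-to w)) (cong from (trivial (to w) (inComp-to-from w∈)))
    where
    inComp-to-from : ∀ {w} → InComp G x y (from c) w → InComp H x′ y′ c (to w)
    inComp-to-from w∈ with inComp-to w∈
    ... | w∉ , r = w∉ , Reach-++ (Reach-sym (to-outside _ (from-outside c c∉)) (to-from c c∉)) r

  module _ (pair-to : ∀ {w} → Pair G x y w → Pair H x′ y′ (to w))
           (pair-from : ∀ {w} → Pair H x′ y′ w → Pair G x y (from w)) where

    inBridge-to : ∀ {c w} → InBridge G x y c w → InBridge H x′ y′ (to c) (to w)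
    inBridge-to = Sum.map pair-to inComp-to

    inBridge-from : ∀ {c w} → InBridge H x′ y′ (to c) w → InBridge G x y c (from w)
    inBridge-from = Sum.map pair-from inComp-from

-- Isomorphisms

module Iso {G H} (i : G ≅ H) where
  open _≅_ i

  to : V G → V H
  to = Inverse.to bij

  from : V H → V G
  from = Inverse.from bij

  from-to : ∀ w → from (to w) ≡ w
  from-to = Inverse.strictlyInverseʳ bij

  to-from : ∀ q → to (from q) ≡ q
  to-from = Inverse.strictlyInverseˡ bij

  to-adj : ∀ {a b} → Adj G a b → Adj H (to a) (to b)
  to-adj = Equivalence.to (pres _ _)

  from-adj : ∀ {a b} → Adj H a b → Adj G (from a) (from b)
  from-adj e = Equivalence.from (pres _ _) (subst₂ (Adj H) (≡.sym (to-from _)) (≡.sym (to-from _)) e)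

  pair-to : ∀ {x y w} → Pair G x y w → Pair H (to x) (to y) (to w)
  pair-to = Pair-map {G} {H} to

  pair-from : ∀ {x y q} → Pair H x y q → Pair G (from x) (from y) (from q)
  pair-from = Pair-map {H} {G} from

  pair-reflect : ∀ {x y q} → Pair H (to x) (to y) q → Pair G x y (from q)
  pair-reflect {x} {y} = Pair-cong {G} (from-to x) (from-to y) ∘ pair-from

  reachEquiv : ∀ {S T} → (∀ {w} → S w → T (to w)) → (∀ {q} → T q → S (from q)) → ReachEquiv G S H T
  reachEquiv {S} {T} S→T T→S = record
    { to = to ; from = from ; from-to = from-to
    ; to-from      = λ q _ → subst (Reach H T (to (from q))) (to-from q) here
    ; to-outside   = to-outside
    ; from-outside = from-outside
    ; to-reach     = Reach-map to to-adj to-outside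
    ; from-reach   = Reach-map from from-adj from-outside
    }
    where
    to-outside : ∀ w → ¬ S w → ¬ T (to w)
    to-outside w w∉ t = w∉ (subst S (from-to w) (T→S t))
    from-outside : ∀ q → ¬ T q → ¬ S (from q)
    from-outside q q∉ s = q∉ (subst T (to-from q) (S→T s))

  pair-equiv : ∀ x y → ReachEquiv G (Pair G x y) H (Pair H (to x) (to y))
  pair-equiv x y = reachEquiv pair-to pair-reflect

  robust : Robust G → Robust H
  robust R = record
    { connected              = ReachEquiv.connected (reachEquiv (λ ()) (λ ())) R.connected
    ; connected-minus-vertex = λ w → pullback w w (R.connected-minus-vertex (from w))
    ; connected-minus-edge   = λ {x} {y} e → pullback x y (R.connected-minus-edge (from-adj e))
    }
    where
    module R = Robust R
    pullback : ∀ x y → Connected G (Pair G (from x) (from y)) → Connected H (Pair H x y)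
    pullback x y = ReachEquiv.connected (reachEquiv (Pair-cong {H} (to-from x) (to-from y) ∘ pair-to) pair-from)

  twoCut-to : ∀ {x y} → TwoCut G x y → TwoCut H (to x) (to y)
  twoCut-to {x} {y} = twoCut-transfer (ReachEquiv.to-injective (pair-equiv x y))
                                      (reachEquiv (λ ()) (λ ())) (pair-equiv x y)

  P2-reflect : ∀ {x y} → P2 H (to x) (to y) → P2 G x y
  P2-reflect {x} {y} = Bridges.P2-reflect (pair-equiv x y)

  P1-reflect : ∀ {x y} → P1 H (to x) (to y) → P1 G x y
  P1-reflect {x} {y} p1 c c∉ =
    Sum.map degOne-reflect degOne-reflect (p1 (to c) (ReachEquiv.to-outside E c c∉))
    where
    E : ReachEquiv G (Pair G x y) H (Pair H (to x) (to y))
    E = pair-equiv x y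
    inBridge-to′ : ∀ {w} → InBridge G x y c w → InBridge H (to x) (to y) (to c) (to w)
    inBridge-to′ = Bridges.inBridge-to E pair-to pair-reflect
    inBridge-from′ : ∀ {w} → InBridge H (to x) (to y) (to c) w → InBridge G x y c (from w)
    inBridge-from′ = Bridges.inBridge-from E pair-to pair-reflect
    degOne-reflect : ∀ {z} → DegOneInBridge H (to x) (to y) (to c) (to z) → DegOneInBridge G x y c z
    degOne-reflect {z} (w , w∈ , zw , unique) =
      from w , inBridge-from′ w∈ , subst (λ t → Adj G t (from w)) (from-to z) (from-adj zw) ,
      λ w′ w′∈ zw′ → trans (≡.sym (from-to w′)) (cong from (unique (to w′) (inBridge-to′ w′∈) (to-adj zw′)))

-- Double subdivision

module Subdivision (G : Graph) {u v : V G} (uv : Adj G u v) where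
  G′ : Graph
  G′ = dsub G u v

  old : V G → V G′
  old w = suc (suc w)

  old-injective : ∀ {a b} → old a ≡ old b → a ≡ b
  old-injective = suc-injective ∘ suc-injective

  new : Fin 2 → V G′
  new zero       = zero
  new (suc zero) = suc zero

  other : Fin 2 → Fin 2
  other zero       = suc zero
  other (suc zero) = zero

  new-other≢new : ∀ i → new (other i) ≢ new i
  new-other≢new zero       ()
  new-other≢new (suc zero) ()

  new≢old : ∀ i {w} → new i ≢ old w
  new≢old zero       ()
  new≢old (suc zero) ()

  End : V G → Set
  End = Pair G u v

  end-new : ∀ {w} → End w → ∀ i → Adj G′ (old w) (new i)
  end-new w-end zero       = w-end
  end-new w-end (suc zero) = w-end

  new-end : ∀ {w} → End w → ∀ i → Adj G′ (new i) (old w)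
  new-end w-end zero       = w-end
  new-end w-end (suc zero) = w-end

  u≢v : u ≢ v
  u≢v u≡v = irrefl G (subst (Adj G u) (≡.sym u≡v) uv)

  end-adj : ∀ {a b} → End a → End b → a ≡ b ⊎ Adj G a b
  end-adj {a} {b} a-end b-end with a ≟ b
  ... | yes a≡b = inj₁ a≡b
  ... | no a≢b with a-end | b-end
  ...   | inj₁ refl | inj₁ refl = ⊥-elim (a≢b refl)
  ...   | inj₁ refl | inj₂ refl = inj₂ uv
  ...   | inj₂ refl | inj₁ refl = inj₂ (Graph.sym G uv)
  ...   | inj₂ refl | inj₂ refl = ⊥-elim (a≢b refl)

  SameEdge : V G → V G → Set
  SameEdge a b = (a ≡ u × b ≡ v) ⊎ (a ≡ v × b ≡ u)

  sameEdge? : ∀ a b → Dec (SameEdge a b)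
  sameEdge? a b = (a ≟ u ×-dec b ≟ v) ⊎-dec (a ≟ v ×-dec b ≟ u)

  sameEdge-adj : ∀ {a b} → SameEdge a b → Adj G a b
  sameEdge-adj (inj₁ (refl , refl)) = uv
  sameEdge-adj (inj₂ (refl , refl)) = Graph.sym G uv

  sameEdge-ends : ∀ {a b} → SameEdge a b → End a × End b
  sameEdge-ends (inj₁ (a≡u , b≡v)) = inj₁ a≡u , inj₂ b≡v
  sameEdge-ends (inj₂ (a≡v , b≡u)) = inj₂ a≡v , inj₁ b≡u

  sameEdge-irrefl : ∀ {a} → ¬ SameEdge a a
  sameEdge-irrefl (inj₁ (a≡u , a≡v)) = u≢v (trans (≡.sym a≡u) a≡v)
  sameEdge-irrefl (inj₂ (a≡v , a≡u)) = u≢v (trans (≡.sym a≡u) a≡v)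

  sameEdge-swap : ∀ {a b} → SameEdge a b → SameEdge b a
  sameEdge-swap (inj₁ (a≡u , b≡v)) = inj₂ (b≡v , a≡u)
  sameEdge-swap (inj₂ (a≡v , b≡u)) = inj₁ (b≡u , a≡v)

  pair-sameEdge : ∀ {x y a b} → Pair G x y a → Pair G x y b → SameEdge a b → SameEdge x y
  pair-sameEdge (inj₁ refl) (inj₁ refl) se = ⊥-elim (sameEdge-irrefl se)
  pair-sameEdge (inj₁ refl) (inj₂ refl) se = se
  pair-sameEdge (inj₂ refl) (inj₁ refl) se = sameEdge-swap se
  pair-sameEdge (inj₂ refl) (inj₂ refl) se = ⊥-elim (sameEdge-irrefl se)

  end-avoiding : ∀ {x y} → ¬ SameEdge x y → Σ (V G) λ r → End r × ¬ Pair G x y r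
  end-avoiding {x} {y} ns with Pair? {G} x y u | Pair? {G} x y v
  ... | no u∉  | _      = u , inj₁ refl , u∉
  ... | yes _  | no v∉  = v , inj₂ refl , v∉
  ... | yes u∈ | yes v∈ = ⊥-elim (ns (pair-sameEdge u∈ v∈ (inj₁ (refl , refl))))

  -- G′ - S′ is G - S with the edge uv rerouted through the surviving new vertex j;
  -- contracting both new vertices onto the surviving end r inverts this.
  module Collapse (S : V G → Set) (S′ : V G′ → Set)
      (S′→S : ∀ {w} → S′ (old w) → S w) (S→S′ : ∀ {w} → S w → S′ (old w))
      {r : V G} (r-end : End r) (r∉ : ¬ S r) (j : Fin 2) (j∉ : ¬ S′ (new j)) where

    back : V G′ → V G
    back zero          = r
    back (suc zero)    = r
    back (suc (suc w)) = w

    back-outside : ∀ q → ¬ S′ q → ¬ S (back q)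
    back-outside zero          _  = r∉
    back-outside (suc zero)    _  = r∉
    back-outside (suc (suc w)) w∉ = w∉ ∘ S→S′

    old-outside : ∀ w → ¬ S w → ¬ S′ (old w)
    old-outside w w∉ = w∉ ∘ S′→S

    back-adj : ∀ {p q} → Adj G′ p q → back p ≡ back q ⊎ Adj G (back p) (back q)
    back-adj {zero}          {suc (suc b)} b-end    = end-adj r-end b-end
    back-adj {suc zero}      {suc (suc b)} b-end    = end-adj r-end b-end
    back-adj {suc (suc a)}   {zero}        a-end    = end-adj a-end r-end
    back-adj {suc (suc a)}   {suc zero}    a-end    = end-adj a-end r-end
    back-adj {suc (suc a)}   {suc (suc b)} (ab , _) = inj₂ ab

    back-reach : ∀ {p q} → Reach G′ S′ p q → Reach G S (back p) (back q)
    back-reach here = here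
    back-reach (there e w∉ wq) with back-adj e
    ... | inj₁ eq = subst (λ t → Reach G S t _) (≡.sym eq) (back-reach wq)
    ... | inj₂ e′ = there e′ (back-outside _ w∉) (back-reach wq)

    old-reach : ∀ {p q} → Reach G S p q → Reach G′ S′ (old p) (old q)
    old-reach here = here
    old-reach {p} (there {v = w} e w∉ wq) with sameEdge? p w
    ... | yes se = there (end-new (proj₁ (sameEdge-ends se)) j) j∉
                     (there (new-end (proj₂ (sameEdge-ends se)) j) (old-outside w w∉) (old-reach wq))
    ... | no ns  = there (e , ns) (old-outside w w∉) (old-reach wq)

    old-back : ∀ q → ¬ S′ q → Reach G′ S′ (old (back q)) q
    old-back zero          q∉ = there (end-new r-end zero) q∉ here
    old-back (suc zero)    q∉ = there (end-new r-end (suc zero)) q∉ here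
    old-back (suc (suc w)) _  = here

    equiv : ReachEquiv G S G′ S′
    equiv = record
      { to = old ; from = back ; from-to = λ _ → refl ; to-from = old-back
      ; to-outside = old-outside ; from-outside = back-outside
      ; to-reach = old-reach ; from-reach = back-reach
      }

  noVertex-equiv : ReachEquiv G (NoVertex G) G′ (NoVertex G′)
  noVertex-equiv = Collapse.equiv (NoVertex G) (NoVertex G′) (λ ()) (λ ()) (inj₁ refl) (λ ()) zero (λ ())

  module OldPair {x y : V G} (ns : ¬ SameEdge x y) where
    new∉ : ∀ i → ¬ Pair G′ (old x) (old y) (new i)
    new∉ i = Sum.[ new≢old i , new≢old i ]

    r : V G
    r = proj₁ (end-avoiding ns)

    r-end : End r
    r-end = proj₁ (proj₂ (end-avoiding ns))

    module C = Collapse (Pair G x y) (Pair G′ (old x) (old y)) (Sum.map old-injective old-injective)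
                        (Pair-map {G} {G′} old) r-end (proj₂ (proj₂ (end-avoiding ns))) zero (new∉ zero)

    equiv : ReachEquiv G (Pair G x y) G′ (Pair G′ (old x) (old y))
    equiv = C.equiv

    twoCut-old : TwoCut G x y → TwoCut G′ (old x) (old y)
    twoCut-old = twoCut-transfer old-injective noVertex-equiv equiv

    P2-reflect : P2 G′ (old x) (old y) → P2 G x y
    P2-reflect = Bridges.P2-reflect equiv

    open Bridges equiv using (inComp-to; inComp-from)

    pair-from : ∀ {q} → Pair G′ (old x) (old y) q → Pair G x y (C.back q)
    pair-from {zero}        p = ⊥-elim (new∉ zero p)
    pair-from {suc zero}    p = ⊥-elim (new∉ (suc zero) p)
    pair-from {suc (suc w)} p = Sum.map old-injective old-injective p

    inBridge-to : ∀ {c w} → InBridge G x y c w → InBridge G′ (old x) (old y) (old c) (old w)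
    inBridge-to = Bridges.inBridge-to equiv (Pair-map {G} {G′} old) pair-from

    inBridge-from : ∀ {c w} → InBridge G′ (old x) (old y) (old c) w → InBridge G x y c (C.back w)
    inBridge-from = Bridges.inBridge-from equiv (Pair-map {G} {G′} old) pair-from

    back-new-end : ∀ i → End (C.back (new i))
    back-new-end zero       = r-end
    back-new-end (suc zero) = r-end

    news-in-bridge : ∀ {c t} → End t → InComp G x y c t → ∀ i → InBridge G′ (old x) (old y) (old c) (new i)
    news-in-bridge t-end t∈ i = inj₂ (new∉ i , Reach-snoc (proj₂ (inComp-to t∈)) (end-new t-end i) (new∉ i))

    -- an end of uv is adjacent to both new vertices
    ¬unique-neighbour : ∀ {c z w} → End z → (∀ i → InBridge G′ (old x) (old y) (old c) (new i)) →
                        ¬ (∀ w′ → InBridge G′ (old x) (old y) (old c) w′ → Adj G′ (old z) w′ → w′ ≡ w)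
    ¬unique-neighbour z-end news unique =
      new-other≢new zero (trans (unique _ (news (suc zero)) (end-new z-end (suc zero)))
                                (≡.sym (unique _ (news zero) (end-new z-end zero))))

    ¬new-unique-neighbour : ∀ {c z} i → InBridge G′ (old x) (old y) (old c) (new i) → End z →
                            ¬ (∀ w′ → InBridge G′ (old x) (old y) (old c) w′ → Adj G′ (old z) w′ → w′ ≡ new i)
    ¬new-unique-neighbour i (inj₁ i∈xy) _     _      = new∉ i i∈xy
    ¬new-unique-neighbour i (inj₂ i∈c)  z-end unique =
      ¬unique-neighbour z-end (news-in-bridge (back-new-end i) (inComp-from i∈c)) unique

    degOne-reflect : ∀ {c z} → Pair G x y z → DegOneInBridge G′ (old x) (old y) (old c) (old z) → DegOneInBridge G x y c z
    degOne-reflect _ (zero , w∈ , z-end , unique) = ⊥-elim (¬new-unique-neighbour zero w∈ z-end unique)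
    degOne-reflect _ (suc zero , w∈ , z-end , unique) = ⊥-elim (¬new-unique-neighbour (suc zero) w∈ z-end unique)
    degOne-reflect {c} {z} z∈ (suc (suc w) , w∈ , (zw , _) , unique) = w , inBridge-from w∈ , zw , unique′
      where
      unique′ : ∀ w′ → InBridge G x y c w′ → Adj G z w′ → w′ ≡ w
      unique′ w′ w′∈ zw′ with sameEdge? z w′
      ... | no ns′ = old-injective (unique (old w′) (inBridge-to w′∈) (zw′ , ns′))
      ... | yes se with w′∈
      ...   | inj₁ w′∈xy = ⊥-elim (ns (pair-sameEdge z∈ w′∈xy se))
      ...   | inj₂ w′∈c  = ⊥-elim (¬unique-neighbour (proj₁ (sameEdge-ends se))
                                      (news-in-bridge (proj₂ (sameEdge-ends se)) w′∈c) unique)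

    P1-reflect : P1 G′ (old x) (old y) → P1 G x y
    P1-reflect p1 c c∉ =
      Sum.map (degOne-reflect (inj₁ refl)) (degOne-reflect (inj₂ refl)) (p1 (old c) (C.old-outside c c∉))

  new-equiv : ∀ i → ReachEquiv G (NoVertex G) G′ (Pair G′ (new i) (new i))
  new-equiv i = Collapse.equiv (NoVertex G) (Pair G′ (new i) (new i))
    (Sum.[ new≢old i ∘ ≡.sym , new≢old i ∘ ≡.sym ]) (λ ())
    (inj₁ refl) (λ ()) (other i) Sum.[ new-other≢new i , new-other≢new i ]

  new-old-equiv : ∀ i b → ReachEquiv G (Pair G b b) G′ (Pair G′ (new i) (old b))
  new-old-equiv i b = Collapse.equiv (Pair G b b) (Pair G′ (new i) (old b))
    Sum.[ ⊥-elim ∘ new≢old i ∘ ≡.sym , inj₁ ∘ old-injective ] Sum.[ inj₂ ∘ cong old , inj₂ ∘ cong old ]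
    (proj₁ (proj₂ (end-avoiding sameEdge-irrefl))) (proj₂ (proj₂ (end-avoiding sameEdge-irrefl)))
    (other i) Sum.[ new-other≢new i , new≢old (other i) ]

  robust : Robust G → Robust G′
  robust R = record
    { connected              = ReachEquiv.connected noVertex-equiv R.connected
    ; connected-minus-vertex = minus-vertex
    ; connected-minus-edge   = minus-edge
    }
    where
    module R = Robust R

    minus-vertex : ∀ w → Connected G′ (Pair G′ w w)
    minus-vertex zero          = ReachEquiv.connected (new-equiv zero) R.connected
    minus-vertex (suc zero)    = ReachEquiv.connected (new-equiv (suc zero)) R.connected
    minus-vertex (suc (suc w)) =
      ReachEquiv.connected (OldPair.equiv sameEdge-irrefl) (R.connected-minus-vertex w)

    minus-new-old : ∀ i b → Connected G′ (Pair G′ (new i) (old b))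
    minus-new-old i b = ReachEquiv.connected (new-old-equiv i b) (R.connected-minus-vertex b)

    minus-edge : ∀ {p q} → Adj G′ p q → Connected G′ (Pair G′ p q)
    minus-edge {zero}        {suc (suc b)} _        = minus-new-old zero b
    minus-edge {suc zero}    {suc (suc b)} _        = minus-new-old (suc zero) b
    minus-edge {suc (suc a)} {zero}        _        = Connected-swap (minus-new-old zero a)
    minus-edge {suc (suc a)} {suc zero}    _        = Connected-swap (minus-new-old (suc zero) a)
    minus-edge {suc (suc a)} {suc (suc b)} (ab , ns) =
      ReachEquiv.connected (OldPair.equiv ns) (R.connected-minus-edge ab)

-- Descent along the subdivision order

AllTwoCuts : ((G : Graph) → V G → V G → Set) → Graph → Set
AllTwoCuts P G = ∀ x y → TwoCut G x y → P G x y

robust-ascend : ∀ {H G} → Robust H → H ≤ᴷ G → Robust G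
robust-ascend R (none i)              = Iso.robust i R
robust-ascend R (step H≤G₀ _ _ uv i) = Iso.robust i (Subdivision.robust _ uv (robust-ascend R H≤G₀))

GenTriangle⇒Robust : ∀ {G} → GenTriangle G → Robust G
GenTriangle⇒Robust = robust-ascend K3-robust

module Descent (P : (G : Graph) → V G → V G → Set)
  (P-reflect-iso : ∀ {G H} (i : G ≅ H) {x y} → P H (Iso.to i x) (Iso.to i y) → P G x y)
  (P-reflect-subdivision : ∀ {G u v} (uv : Adj G u v) {x y} → ¬ Subdivision.SameEdge G uv x y →
                           P (dsub G u v) (suc (suc x)) (suc (suc y)) → P G x y) where

  allTwoCuts-iso : ∀ {G H} → G ≅ H → AllTwoCuts P H → AllTwoCuts P G
  allTwoCuts-iso i all x y cut = P-reflect-iso i (all _ _ (Iso.twoCut-to i cut))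

  allTwoCuts-subdivision : ∀ {G u v} (uv : Adj G u v) → Robust G → AllTwoCuts P (dsub G u v) → AllTwoCuts P G
  allTwoCuts-subdivision {G} uv R all x y cut with Subdivision.sameEdge? G uv x y
  ... | yes se = ⊥-elim (edge⇒¬TwoCut R (Subdivision.sameEdge-adj G uv se) cut)
  ... | no ns  = P-reflect-subdivision uv ns (all _ _ (Subdivision.OldPair.twoCut-old G uv ns cut))

  allTwoCuts-descend : ∀ {H G} → H ≤ᴷ G → Robust H → AllTwoCuts P G → AllTwoCuts P H
  allTwoCuts-descend (none i)              _ all = allTwoCuts-iso i all
  allTwoCuts-descend (step H≤G₀ _ _ uv i) R all =
    allTwoCuts-descend H≤G₀ R (allTwoCuts-subdivision uv (robust-ascend R H≤G₀) (allTwoCuts-iso i all))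

  downwardClosed : DownwardClosed (λ G → GenTriangle G × AllTwoCuts P G)
  downwardClosed G H (_ , all) H-triangle H≤G =
    H-triangle , allTwoCuts-descend H≤G (GenTriangle⇒Robust H-triangle) all

lemma3p2 : ((∀ G → K₁ G → GenTriangle G) × DownwardClosed K₁) × ((∀ G → K₂ G → GenTriangle G) × DownwardClosed K₂)
lemma3p2 =
  ((λ _ → proj₁) , Descent.downwardClosed P1 Iso.P1-reflect (λ {G} uv → Subdivision.OldPair.P1-reflect G uv)) ,
  ((λ _ → proj₁) , Descent.downwardClosed P2 Iso.P2-reflect (λ {G} uv → Subdivision.OldPair.P2-reflect G uv))
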